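{- Let $P$ be a finite set of propositions, $\Pi = 2^P$, let $\phi$ be a formula of the LTL fragment described in the context, and let $\pi \in \Pi^*$ be a finite trace with $|\pi| \neq 0$. Then $\mu_\pi(\phi,1) = \top \Rightarrow [\pi \models_3 \phi] = \top$, and $\mu_\pi(\phi,1) = \bot \Rightarrow [\pi \models_3 \phi] = \bot$.
   Context: A trace is a finite or infinite sequence $\pi = \pi_1\pi_2\dots$ of elements of $\Pi=2^P$; $|\pi|$ is its length and $\pi\cdot\pi'$ denotes concatenation. LTL formulas of the fragment considered are generated by $\phi ::= p \mid \neg\phi \mid \phi_1\vee\phi_2 \mid \mathbf{X}\phi \mid \phi_1\,\mathbf{U}\,\phi_2 \mid \mathbf{F}\phi$ with $p\in P$ (no constant symbols $\top,\bot$). Abbreviations: $\phi_1\wedge\phi_2 = \neg(\neg\phi_1\vee\neg\phi_2)$, $\mathbf{G}\phi=\neg\mathbf{F}\neg\phi$. Classical semantics on an infinite trace $\pi\in\Pi^\omega$: $(\pi,i)\models p$ iff $p\in\pi_i$; $\neg$ and $\vee$ as usual; $(\pi,i)\models\mathbf{X}\phi$ iff $(\pi,i+1)\models\phi$; $(\pi,i)\models\phi_1\mathbf{U}\phi_2$ iff there is $j\ge i$ with $(\pi,j)\models\phi_2$ and $(\pi,k)\models\phi_1$ for all $i\le k<j$; $\mathbf{F}\phi$ means $\mathrm{true}\,\mathbf{U}\,\phi$. Write $\pi\models\phi$ for $(\pi,1)\models\phi$. Three-valued semantics for $\pi\in\Pi^*$: $[\pi\models_3\phi]=\top$ if $\pi\cdot\pi'\models\phi$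 for all $\pi'\in\Pi^\omega$; $=\bot$ if $\pi\cdot\pi'\not\models\phi$ for all $\pi'\in\Pi^\omega$; $=\,?$ otherwise. Adapted three-valued semantics $\mu_\pi(\phi,i)\in\{\bot,?,\top\}$ for $i\in\mathbb{N}_{>0}$, with order $\bot<?<\top$, $\neg_3\top=\bot$, $\neg_3\bot=\top$, $\neg_3?=?$, $x\vee_3 y=\max(x,y)$, $x\wedge_3 y=\min(x,y)$: $\mu_\pi(p,i)=\top$ if $i\le|\pi|$ and $p\in\pi_i$; $=\bot$ if $i\le|\pi|$ and $p\notin\pi_i$; $=\,?$ if $i>|\pi|$. $\mu_\pi(\neg\phi,i)=\neg_3\mu_\pi(\phi,i)$; $\mu_\pi(\phi_1\vee\phi_2,i)=\mu_\pi(\phi_1,i)\vee_3\mu_\pi(\phi_2,i)$; $\mu_\pi(\mathbf{X}\phi,i)=\mu_\pi(\phi,i+1)$. $\mu_\pi(\mathbf{F}\phi,i)=\mu_\pi(\phi,i)\vee_3\mu_\pi(\mathbf{X}\mathbf{F}\phi,i)$ if $i\le|\pi|$, and $=\mu_\pi(\phi,i)$ if $i>|\pi|$. $\mu_\pi(\phi_1\mathbf{U}\phi_2,i)=\mu_\pi(\phi_2,i)\vee_3(\mu_\pi(\phi_1,i)\wedge_3\mu_\pi(\mathbf{X}(\phi_1\mathbf{U}\phi_2),i))$ if $i\le|\pi|$, and $=\mu_\pi(\phi_2,i)$ if $i>|\pi|$. -}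

module Defs where

open import Data.Nat using (ℕ; zero; suc; _∸_; _≤_)
open import Data.Fin using (Fin)
open import Data.Fin.Subset using (Subset; _∈_; _∉_)
open import Data.List using (List; []; _∷_; length)
open import Data.Product using (Σ; _×_; _,_)
open import Data.Sum using (_⊎_)
open import Relation.Nullary using (¬_; yes; no)
open import Data.Fin.Subset.Properties using (_∈?_)

Letter : ℕ → Set
Letter n = Subset n

data Formula (n : ℕ) : Set where
  atom : Fin n → Formula n
  neg  : Formula n → Formula n
  or   : Formula n → Formula n → Formula n
  next : Formula n → Formula n
  until : Formula n → Formula n → Formula n
  eventually : Formula n → Formula n

-- Infinite traces π ∈ Π^ω: the function w represents π_1 π_2 …  with π_i = w (i ∸ 1).
InfTrace : ℕ → Set
InfTrace n = ℕ → Letter n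

-- Classical semantics (π , i) ⊨ φ, positions i ∈ ℕ_{>0} (1-based).
sat : ∀ {n} → InfTrace n → ℕ → Formula n → Set
sat w i (atom p) = p ∈ w (i ∸ 1)
sat w i (neg φ) = ¬ sat w i φ
sat w i (or φ ψ) = sat w i φ ⊎ sat w i ψ
sat w i (next φ) = sat w (suc i) φ
sat w i (until φ ψ) =
  Σ ℕ λ j → i ≤ j × sat w j ψ × (∀ k → i ≤ k → suc k ≤ j → sat w k φ)
sat w i (eventually φ) = Σ ℕ λ j → i ≤ j × sat w j φ

_⊨_ : ∀ {n} → InfTrace n → Formula n → Set
w ⊨ φ = sat w 1 φ

_·_ : ∀ {n} → List (Letter n) → InfTrace n → InfTrace n
([] · w) k = w k
((x ∷ xs) · w) zero = x
((x ∷ xs) · w) (suc k) = (xs · w) k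

-- Truth values {⊥, ?, ⊤} ordered ⊥ < ? < ⊤.
data V : Set where
  ff unk tt : V

¬₃ : V → V
¬₃ ff = tt
¬₃ unk = unk
¬₃ tt = ff

_∨₃_ : V → V → V
tt ∨₃ _ = tt
ff ∨₃ y = y
unk ∨₃ tt = tt
unk ∨₃ _ = unk

_∧₃_ : V → V → V
ff ∧₃ _ = ff
tt ∧₃ y = y
unk ∧₃ ff = ff
unk ∧₃ _ = unk

Models3 : ∀ {n} → List (Letter n) → Formula n → V → Set
Models3 π φ tt = ∀ (w : InfTrace _) → (π · w) ⊨ φ
Models3 π φ ff = ∀ (w : InfTrace _) → ¬ ((π · w) ⊨ φ)
Models3 π φ unk = ¬ (∀ (w : InfTrace _) → (π · w) ⊨ φ) × ¬ (∀ (w : InfTrace _) → ¬ ((π · w) ⊨ φ))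

-- Value of an atom p at 1-based position i of the finite trace π:
-- ⊤ / ⊥ if 1 ≤ i ≤ |π| according to p ∈ π_i, and ? if i > |π|.
-- (Position 0 is never used; it is given value ? arbitrarily.)
atomVal : ∀ {n} → List (Letter n) → ℕ → Fin n → V
atomVal [] i p = unk
atomVal (x ∷ xs) zero p = unk
atomVal (x ∷ xs) (suc zero) p with p ∈? x
... | yes _ = tt
... | no _ = ff
atomVal (x ∷ xs) (suc (suc i)) p = atomVal xs (suc i) p

-- Unrolling of μ(F φ, i):  with k = |π| + 1 ∸ i,
--   Fgo f i (suc k) = f i ∨₃ Fgo f (i+1) k     (case i ≤ |π|)
--   Fgo f i zero    = f i                       (case i > |π|)
Fgo : (ℕ → V) → ℕ → ℕ → V
Fgo f i zero = f i
Fgo f i (suc k) = f i ∨₃ Fgo f (suc i) k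

Ugo : (ℕ → V) → (ℕ → V) → ℕ → ℕ → V
Ugo f g i zero = g i
Ugo f g i (suc k) = g i ∨₃ (f i ∧₃ Ugo f g (suc i) k)

μ : ∀ {n} → List (Letter n) → Formula n → ℕ → V
μ π (atom p) i = atomVal π i p
μ π (neg φ) i = ¬₃ (μ π φ i)
μ π (or φ ψ) i = μ π φ i ∨₃ μ π ψ i
μ π (next φ) i = μ π φ (suc i)
μ π (until φ ψ) i = Ugo (μ π φ) (μ π ψ) i (suc (length π) ∸ i)
μ π (eventually φ) i = Fgo (μ π φ) i (suc (length π) ∸ i)

-- Induction on φ shows, for every extension w of π and every position i, that
-- μ_π(φ, i) = ⊤ forces (π·w, i) ⊨ φ and μ_π(φ, i) = ⊥ forces (π·w, i) ⊭ φ.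
-- The Boolean cases hold because ¬₃, ∨₃, ∧₃ only commit to ⊤/⊥ when their
-- arguments do; the U case follows the expansion law
-- φ U ψ ≡ ψ ∨ (φ ∧ X (φ U ψ)), which is exactly how μ unrolls it, and F φ is
-- true U φ. The unrolling stops past the end of π, where μ is ? and hence
-- never wrongly ⊥.
module Submission where

open import Defs
open import Data.Nat using (ℕ; zero; suc; _+_; _∸_; _≤_; _<_; s≤s)
open import Data.Nat.Properties
  using (≤-refl; ≤-trans; n≤1+n; <⇒≤; <⇒≱; m≤n⇒m<n∨m≡n; m≤n⇒m∸n≡0; m≤n+m∸n; +-identityʳ; +-suc)
open import Data.List using (List; []; _∷_; length)
open import Data.Product using (_×_; _,_; proj₁; proj₂; Σ)
open import Data.Sum using (_⊎_; inj₁; inj₂; [_,_])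
open import Data.Unit using (⊤)
open import Data.Empty using (⊥-elim)
open import Data.Fin.Subset using (_∈_)
open import Data.Fin.Subset.Properties using (_∈?_)
open import Function using (_∘_)
open import Function.Bundles using (_⇔_; mk⇔; Equivalence)
open import Relation.Nullary using (¬_; yes; no; contradiction)
open import Relation.Binary.PropositionalEquality using (_≡_; _≢_; refl; sym; trans; cong; subst)

Sound : V → Set → Set
Sound v S = (v ≡ tt → S) × (v ≡ ff → ¬ S)

Sound-⇔ : ∀ {S T v} → S ⇔ T → Sound v S → Sound v T
Sound-⇔ S⇔T (s , ¬s) = Equivalence.to S⇔T ∘ s , λ e → ¬s e ∘ Equivalence.from S⇔T

Sound-¬₃ : ∀ {S v} → Sound v S → Sound (¬₃ v) (¬ S)
Sound-¬₃ {v = tt} (s , _) = (λ ()) , λ _ ¬s → ¬s (s refl)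
Sound-¬₃ {v = ff} (_ , ¬s) = (λ _ → ¬s refl) , λ ()
Sound-¬₃ {v = unk} _ = (λ ()) , (λ ())

Sound-∨₃ : ∀ {S T u v} → Sound u S → Sound v T → Sound (u ∨₃ v) (S ⊎ T)
Sound-∨₃ {u = tt} (s , _) _ = (λ _ → inj₁ (s refl)) , λ ()
Sound-∨₃ {u = ff} (_ , ¬s) (t , ¬t) = inj₂ ∘ t , λ e → [ ¬s refl , ¬t e ]
Sound-∨₃ {u = unk} {v = tt} _ (t , _) = (λ _ → inj₂ (t refl)) , λ ()
Sound-∨₃ {u = unk} {v = ff} _ _ = (λ ()) , (λ ())
Sound-∨₃ {u = unk} {v = unk} _ _ = (λ ()) , (λ ())

Sound-∧₃ : ∀ {S T u v} → Sound u S → Sound v T → Sound (u ∧₃ v) (S × T)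
Sound-∧₃ {u = ff} (_ , ¬s) _ = (λ ()) , λ _ → ¬s refl ∘ proj₁
Sound-∧₃ {u = tt} (s , _) (t , ¬t) = (λ e → s refl , t e) , λ e → ¬t e ∘ proj₂
Sound-∧₃ {u = unk} {v = ff} _ (_ , ¬t) = (λ ()) , λ _ → ¬t refl ∘ proj₂
Sound-∧₃ {u = unk} {v = tt} _ _ = (λ ()) , (λ ())
Sound-∧₃ {u = unk} {v = unk} _ _ = (λ ()) , (λ ())

-- Stated so that sat w i (until φ ψ) and sat w i (eventually φ) are definitionally instances.
Until : (ℕ → Set) → (ℕ → Set) → ℕ → Set
Until A B i = Σ ℕ λ j → i ≤ j × B j × (∀ k → i ≤ k → suc k ≤ j → A k)

Eventually : (ℕ → Set) → ℕ → Set
Eventually A i = Σ ℕ λ j → i ≤ j × A j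

module _ {A B : ℕ → Set} {i : ℕ} where

  Until-expansion : (B i ⊎ (A i × Until A B (suc i))) ⇔ Until A B i
  Until-expansion = mk⇔ fold unfold
    where
    fold : B i ⊎ (A i × Until A B (suc i)) → Until A B i
    fold (inj₁ b) = i , ≤-refl , b , λ k i≤k k<i → contradiction i≤k (<⇒≱ k<i)
    fold (inj₂ (a , j , i<j , b , as)) = j , <⇒≤ i<j , b , before
      where
      before : ∀ k → i ≤ k → suc k ≤ j → A k
      before k i≤k k<j with m≤n⇒m<n∨m≡n i≤k
      ... | inj₁ i<k = as k i<k k<j
      ... | inj₂ refl = a

    unfold : Until A B i → B i ⊎ (A i × Until A B (suc i))
    unfold (j , i≤j , b , as) with m≤n⇒m<n∨m≡n i≤j
    ... | inj₂ refl = inj₁ b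
    ... | inj₁ i<j = inj₂ (as i ≤-refl i<j , j , i<j , b , λ k i<k → as k (<⇒≤ i<k))

Until-⊤⇔Eventually : ∀ {A i} → Until (λ _ → ⊤) A i ⇔ Eventually A i
Until-⊤⇔Eventually = mk⇔ (λ (j , i≤j , a , _) → j , i≤j , a) (λ (j , i≤j , a) → j , i≤j , a , _)

Ugo-sound : ∀ {f g A B} → (∀ j → Sound (f j) (A j)) → (∀ j → Sound (g j) (B j)) →
  ∀ i k → g (i + k) ≢ ff → Sound (Ugo f g i k) (Until A B i)
Ugo-sound {g = g} _ sg i zero last =
  Equivalence.to Until-expansion ∘ inj₁ ∘ proj₁ (sg i) ,
  λ e → ⊥-elim (last (trans (cong g (+-identityʳ i)) e))
Ugo-sound {g = g} sf sg i (suc k) last =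
  Sound-⇔ Until-expansion
    (Sound-∨₃ (sg i) (Sound-∧₃ (sf i) (Ugo-sound sf sg (suc i) k (last ∘ trans (cong g (+-suc i k))))))

Fgo≡Ugo-tt : ∀ f i k → Fgo f i k ≡ Ugo (λ _ → tt) f i k
Fgo≡Ugo-tt f i zero = refl
Fgo≡Ugo-tt f i (suc k) = cong (f i ∨₃_) (Fgo≡Ugo-tt f (suc i) k)

Fgo-sound : ∀ {f A} → (∀ j → Sound (f j) (A j)) →
  ∀ i k → f (i + k) ≢ ff → Sound (Fgo f i k) (Eventually A i)
Fgo-sound {f} sf i k last =
  subst (λ v → Sound v _) (sym (Fgo≡Ugo-tt f i k))
    (Sound-⇔ Until-⊤⇔Eventually (Ugo-sound (λ _ → (λ _ → _) , λ ()) sf i k last))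

atomVal-beyond : ∀ {n} (π : List (Letter n)) i p → length π < i → atomVal π i p ≡ unk
atomVal-beyond [] i p _ = refl
atomVal-beyond (x ∷ xs) zero p _ = refl
atomVal-beyond (x ∷ xs) (suc (suc i)) p (s≤s |xs|<1+i) = atomVal-beyond xs (suc i) p |xs|<1+i

μ-beyond : ∀ {n} (φ : Formula n) π i → length π < i → μ π φ i ≡ unk
μ-beyond (atom p) π i |π|<i = atomVal-beyond π i p |π|<i
μ-beyond (neg φ) π i |π|<i rewrite μ-beyond φ π i |π|<i = refl
μ-beyond (or φ ψ) π i |π|<i rewrite μ-beyond φ π i |π|<i | μ-beyond ψ π i |π|<i = refl
μ-beyond (next φ) π i |π|<i = μ-beyond φ π (suc i) (≤-trans |π|<i (n≤1+n i))
μ-beyond (until φ ψ) π i |π|<i rewrite m≤n⇒m∸n≡0 |π|<i = μ-beyond ψ π i |π|<i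
μ-beyond (eventually φ) π i |π|<i rewrite m≤n⇒m∸n≡0 |π|<i = μ-beyond φ π i |π|<i

μ-unrolled-end-≢ff : ∀ {n} (φ : Formula n) π i → μ π φ (i + (suc (length π) ∸ i)) ≢ ff
μ-unrolled-end-≢ff φ π i e with () ← trans (sym (μ-beyond φ π _ (m≤n+m∸n (suc (length π)) i))) e

atomVal-sound : ∀ {n} (π : List (Letter n)) w i p → Sound (atomVal π i p) (p ∈ (π · w) (i ∸ 1))
atomVal-sound [] w i p = (λ ()) , (λ ())
atomVal-sound (x ∷ xs) w zero p = (λ ()) , (λ ())
atomVal-sound (x ∷ xs) w (suc zero) p with p ∈? x
... | yes p∈x = (λ _ → p∈x) , (λ ())
... | no p∉x = (λ ()) , (λ _ → p∉x)
atomVal-sound (x ∷ xs) w (suc (suc i)) p = atomVal-sound xs w (suc i) p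

μ-sound : ∀ {n} (φ : Formula n) π w i → Sound (μ π φ i) (sat (π · w) i φ)
μ-sound (atom p) π w i = atomVal-sound π w i p
μ-sound (neg φ) π w i = Sound-¬₃ (μ-sound φ π w i)
μ-sound (or φ ψ) π w i = Sound-∨₃ (μ-sound φ π w i) (μ-sound ψ π w i)
μ-sound (next φ) π w i = μ-sound φ π w (suc i)
μ-sound (until φ ψ) π w i =
  Ugo-sound (μ-sound φ π w) (μ-sound ψ π w) i (suc (length π) ∸ i) (μ-unrolled-end-≢ff ψ π i)
μ-sound (eventually φ) π w i =
  Fgo-sound (μ-sound φ π w) i (suc (length π) ∸ i) (μ-unrolled-end-≢ff φ π i)

-- Soundness holds at every position of every trace.
lemma1 : ∀ {n : ℕ} (φ : Formula n) (π : List (Letter n)) → length π ≢ 0 →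
    (μ π φ 1 ≡ tt → Models3 π φ tt) × (μ π φ 1 ≡ ff → Models3 π φ ff)
lemma1 φ π _ = (λ e w → proj₁ (μ-sound φ π w 1) e) , (λ e w → proj₂ (μ-sound φ π w 1) e)
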